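{- If $G$ is a finite abelian group and $B,C\subseteq G$ satisfy $\min\{|B|,|C|\}\ge 2$, then $$|B\oplus_2 C|\ge\min\{2|B|+2|C|-4-|G|,\ |B|-1\}.$$
   Context: For subsets $B,C$ of an abelian group, $B\oplus_2 C$ denotes the set of all group elements $x$ having at least two (ordered) representations $x=b+c$ with $b\in B$ and $c\in C$, i.e. at least two pairs $(b,c)\in B\times C$ with $b+c=x$. -}

module Defs where

open import Data.Nat using (ℕ; _≤_; _≤?_)
open import Data.Fin using (Fin)
open import Data.Fin.Properties using (_≟_)
open import Data.Fin.Subset using (Subset; _∈_)
open import Data.Fin.Subset.Properties using (_∈?_)
open import Data.Product using (_×_; _,_; proj₁; proj₂)
open import Relation.Nullary using (Dec)
open import Data.List using (List; length; filter; cartesianProduct; allFin)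
open import Data.Vec using (tabulate)
open import Relation.Nullary.Decidable using (_×-dec_; ⌊_⌋)
open import Relation.Binary.PropositionalEquality using (_≡_)
open import Algebra.Structures using (IsAbelianGroup)

-- A finite abelian group of order n, presented (up to isomorphism) on the
-- carrier Fin n with propositional equality.
record FiniteAbelianGroup (n : ℕ) : Set where
  field
    _+_ : Fin n → Fin n → Fin n
    0#  : Fin n
    -_  : Fin n → Fin n
    isAbelianGroup : IsAbelianGroup _≡_ _+_ 0# -_

repCount : ∀ {n} → FiniteAbelianGroup n → Subset n → Subset n → Fin n → ℕ
repCount {n} G B C x =
  length (filter (λ p → P p) (cartesianProduct (allFin n) (allFin n)))
  where
  open FiniteAbelianGroup G
  P : (p : Fin n × Fin n) → Dec (proj₁ p ∈ B × (proj₂ p ∈ C × (proj₁ p + proj₂ p) ≡ x))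
  P (b , c) = (b ∈? B) ×-dec ((c ∈? C) ×-dec ((b + c) ≟ x))

⊕₂ : ∀ {n} → FiniteAbelianGroup n → Subset n → Subset n → Subset n
⊕₂ G B C = tabulate (λ x → ⌊ 2 ≤? repCount G B C x ⌋)

module Submission where

-- Write r(x) for the number of pairs (b , c) ∈ B × C with b + c = x, let
-- T = B ⊕₂ C and τ = |T|.  The proof is a double count.
--   * Every x ∉ T has r(x) ≤ 1, hence  Σ_{x ∉ T} r(x) + τ ≤ |G|.
--   * Σ_{x ∉ T} r(x) is the number of pairs (b , c) ∈ B × C with b + c ∉ T.
--     For a fixed c at most τ elements b have b + c ∈ T (the translate of T
--     by -c has τ elements), so this number is at least |C| (|B| ∸ τ).
-- Together:  |C| (|B| ∸ τ) + τ ≤ |G|.  The corollary follows by arithmetic: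
-- either |B| ≤ τ + 1, or d = |B| ∸ τ ≥ 2 and (|C| - 2)(d - 2) ≥ 0 turns the
-- inequality into 2|B| + 2|C| - 4 - |G| ≤ τ.

open import Defs
open import Algebra.Bundles using (Group)
open import Algebra.Structures using (IsAbelianGroup)
open import Data.Bool using (Bool; true; false; _∧_; not)
open import Data.Fin using (Fin; zero; suc)
open import Data.Fin.Permutation using (Permutation′; permutation)
open import Data.Fin.Properties using (_≟_)
open import Data.Fin.Subset using (Subset; ∣_∣; inside; outside)
open import Data.Fin.Subset.Properties using (_∈?_)
open import Data.List using (List; _++_; filter; length; map; cartesianProduct; allFin; tabulate)
open import Data.List.Properties using (filter-++; length-++; map-tabulate)
open import Data.Nat using (ℕ; zero; suc; _+_; _*_; _∸_; _≤_; _≤?_; z≤n; s≤s; s≤s⁻¹)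
open import Data.Nat.Properties
  using (+-*-semiring; *-commutativeSemigroup; module ≤-Reasoning; ≤-trans; ≰⇒>; +-comm; +-identityʳ; *-identityˡ;
         +-mono-≤; +-monoˡ-≤; +-monoʳ-≤; *-monoʳ-≤; ∸-monoˡ-≤; m≤m+n; m+n≤o⇒n≤o; m≤n+o⇒m∸n≤o;
         m+n∸m≡n; m+n∸n≡m; m∸n+n≡m)
open import Data.Nat.Tactic.RingSolver using (solve-∀)
open import Data.Product using (_×_; _,_)
open import Data.Vec using ([]; _∷_; lookup)
open import Data.Vec.Properties using (lookup∘tabulate)
open import Function using (_∘_; id)
open import Level using (0ℓ)
open import Relation.Nullary using (does; yes; no)
open import Relation.Nullary.Decidable using (⌊_⌋)
open import Relation.Unary using (Pred; Decidable)
open import Relation.Binary.PropositionalEquality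
open import Algebra.Properties.CommutativeSemigroup *-commutativeSemigroup using (x∙yz≈y∙xz)
open import Algebra.Properties.Semiring.Sum +-*-semiring
  using (sum-syntax; sum-cong-≗; sum-replicate-zero; ∑-comm; ∑-distrib-+; ∑-permute; *-distribˡ-sum; *-distribʳ-sum)

𝟙 : Bool → ℕ
𝟙 true  = 1
𝟙 false = 0

𝟙-∧ : ∀ a b → 𝟙 (a ∧ b) ≡ 𝟙 a * 𝟙 b
𝟙-∧ true  b = sym (*-identityˡ (𝟙 b))
𝟙-∧ false b = refl

𝟙-not : ∀ b → 𝟙 (not b) + 𝟙 b ≡ 1
𝟙-not true  = refl
𝟙-not false = refl

-- Pointwise form of |A| ≤ |A ∖ S| + |S|: an element of A lies either
-- outside S (first summand) or inside S (second summand).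
𝟙-split : ∀ a b → 𝟙 a ≤ 𝟙 a * 𝟙 (not b) + 𝟙 b
𝟙-split true  true  = s≤s z≤n
𝟙-split true  false = s≤s z≤n
𝟙-split false b     = z≤n

∑-mono-≤ : ∀ {n} {f g : Fin n → ℕ} → (∀ i → f i ≤ g i) → ∑[ i < n ] f i ≤ ∑[ i < n ] g i
∑-mono-≤ {zero}  _   = z≤n
∑-mono-≤ {suc n} f≤g = +-mono-≤ (f≤g zero) (∑-mono-≤ (f≤g ∘ suc))

∑-one : ∀ n → ∑[ i < n ] 1 ≡ n
∑-one zero    = refl
∑-one (suc n) = cong suc (∑-one n)

∑-pick : ∀ {n} (y : Fin n) (f : Fin n → ℕ) → ∑[ x < n ] (𝟙 (does (y ≟ x)) * f x) ≡ f y
∑-pick {suc n} zero    f = trans (cong₂ _+_ (*-identityˡ (f zero)) (sum-replicate-zero n)) (+-identityʳ (f zero))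
∑-pick {suc n} (suc y) f = ∑-pick y (f ∘ suc)

does-∈? : ∀ {n} (i : Fin n) (S : Subset n) → does (i ∈? S) ≡ lookup S i
does-∈? zero    (inside  ∷ S) = refl
does-∈? zero    (outside ∷ S) = refl
does-∈? (suc i) (s ∷ S)       = does-∈? i S

∣S∣≡∑𝟙∈ : ∀ {n} (S : Subset n) → ∣ S ∣ ≡ ∑[ i < n ] 𝟙 (does (i ∈? S))
∣S∣≡∑𝟙∈ []            = refl
∣S∣≡∑𝟙∈ (inside  ∷ S) = cong suc (∣S∣≡∑𝟙∈ S)
∣S∣≡∑𝟙∈ (outside ∷ S) = ∣S∣≡∑𝟙∈ S

length-filter-tabulate : ∀ {a p} {A : Set a} {P : Pred A p} (P? : Decidable P) {n} (f : Fin n → A) →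
  length (filter P? (tabulate f)) ≡ ∑[ i < n ] 𝟙 (does (P? (f i)))
length-filter-tabulate P? {zero}  f = refl
length-filter-tabulate P? {suc n} f with does (P? (f zero))
... | true  = cong suc (length-filter-tabulate P? (f ∘ suc))
... | false = length-filter-tabulate P? (f ∘ suc)

length-filter-cartesianProduct : ∀ {a b p} {A : Set a} {B : Set b} {P : Pred (A × B) p}
  (P? : Decidable P) {m} (f : Fin m → A) (ys : List B) →
  length (filter P? (cartesianProduct (tabulate f) ys))
    ≡ ∑[ i < m ] length (filter P? (map (f i ,_) ys))
length-filter-cartesianProduct P? {zero}  f ys = refl
length-filter-cartesianProduct P? {suc m} f ys = begin
  length (filter P? (map (f zero ,_) ys ++ cartesianProduct (tabulate (f ∘ suc)) ys))
    ≡⟨ cong length (filter-++ P? (map (f zero ,_) ys) _) ⟩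
  length (filter P? (map (f zero ,_) ys) ++ filter P? (cartesianProduct (tabulate (f ∘ suc)) ys))
    ≡⟨ length-++ (filter P? (map (f zero ,_) ys)) ⟩
  length (filter P? (map (f zero ,_) ys)) + length (filter P? (cartesianProduct (tabulate (f ∘ suc)) ys))
    ≡⟨ cong (length (filter P? (map (f zero ,_) ys)) +_) (length-filter-cartesianProduct P? (f ∘ suc) ys) ⟩
  length (filter P? (map (f zero ,_) ys)) + ∑[ i < m ] length (filter P? (map (f (suc i) ,_) ys)) ∎
  where open ≡-Reasoning

count-pairs : ∀ {p} {m n} {P : Pred (Fin m × Fin n) p} (P? : Decidable P) →
  length (filter P? (cartesianProduct (allFin m) (allFin n)))
    ≡ ∑[ i < m ] ∑[ j < n ] 𝟙 (does (P? (i , j)))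
count-pairs {n = n} P? = trans (length-filter-cartesianProduct P? id (allFin n))
  (sum-cong-≗ λ i → trans (cong (length ∘ filter P?) (map-tabulate id (i ,_)))
                          (length-filter-tabulate P? (i ,_)))

module _ {n} (G : FiniteAbelianGroup n) where
  open FiniteAbelianGroup G renaming (_+_ to _⊹_)

  G-group : Group 0ℓ 0ℓ
  G-group = record { isGroup = IsAbelianGroup.isGroup isAbelianGroup }

  open import Algebra.Properties.Group G-group using (//-rightDividesˡ; //-rightDividesʳ)

  translation : Fin n → Permutation′ n
  translation c = permutation (_⊹ c) (_⊹ - c) (//-rightDividesˡ c) (//-rightDividesʳ c)

  ∑-translate : (f : Fin n → ℕ) (c : Fin n) → ∑[ b < n ] f (b ⊹ c) ≡ ∑[ x < n ] f x
  ∑-translate f c = sym (∑-permute f (translation c))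

  module _ (B C : Subset n) where

    r : Fin n → ℕ
    r = repCount G B C

    β γ : Fin n → ℕ
    β b = 𝟙 (does (b ∈? B))
    γ c = 𝟙 (does (c ∈? C))

    repCount≡∑ : ∀ x → r x ≡ ∑[ b < n ] ∑[ c < n ] (β b * (γ c * 𝟙 (does ((b ⊹ c) ≟ x))))
    repCount≡∑ x = trans (count-pairs {m = n} {n = n} _) (sum-cong-≗ λ b → sum-cong-≗ λ c →
      trans (𝟙-∧ (does (b ∈? B)) _) (cong (β b *_) (𝟙-∧ (does (c ∈? C)) _)))

    ∑-weighted-repCount : (w : Fin n → ℕ) →
      ∑[ x < n ] (w x * r x) ≡ ∑[ b < n ] ∑[ c < n ] (β b * (γ c * w (b ⊹ c)))
    ∑-weighted-repCount w = begin
      ∑[ x < n ] (w x * r x)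
        ≡⟨ sum-cong-≗ {n} (λ x → cong (w x *_) (repCount≡∑ x)) ⟩
      ∑[ x < n ] (w x * ∑[ b < n ] ∑[ c < n ] (β b * (γ c * δ (b ⊹ c) x)))
        ≡⟨ sum-cong-≗ {n} (λ x → trans (*-distribˡ-sum {n} (w x) _) (sum-cong-≗ {n} λ b → *-distribˡ-sum {n} (w x) _)) ⟩
      ∑[ x < n ] ∑[ b < n ] ∑[ c < n ] (w x * (β b * (γ c * δ (b ⊹ c) x)))
        ≡⟨ ∑-comm {n} {n} _ ⟩
      ∑[ b < n ] ∑[ x < n ] ∑[ c < n ] (w x * (β b * (γ c * δ (b ⊹ c) x)))
        ≡⟨ sum-cong-≗ {n} (λ b → ∑-comm {n} {n} _) ⟩
      ∑[ b < n ] ∑[ c < n ] ∑[ x < n ] (w x * (β b * (γ c * δ (b ⊹ c) x)))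
        ≡⟨ sum-cong-≗ {n} (λ b → sum-cong-≗ {n} λ c → collapse b c) ⟩
      ∑[ b < n ] ∑[ c < n ] (β b * (γ c * w (b ⊹ c))) ∎
      where
      open ≡-Reasoning
      δ : Fin n → Fin n → ℕ
      δ y x = 𝟙 (does (y ≟ x))

      reorder : ∀ u v s t → u * (v * (s * t)) ≡ v * (s * (t * u))
      reorder = solve-∀

      collapse : ∀ b c → ∑[ x < n ] (w x * (β b * (γ c * δ (b ⊹ c) x))) ≡ β b * (γ c * w (b ⊹ c))
      collapse b c = begin
        ∑[ x < n ] (w x * (β b * (γ c * δ (b ⊹ c) x)))
          ≡⟨ sum-cong-≗ {n} (λ x → reorder (w x) (β b) (γ c) (δ (b ⊹ c) x)) ⟩
        ∑[ x < n ] (β b * (γ c * (δ (b ⊹ c) x * w x)))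
          ≡⟨ sym (trans (cong (β b *_) (*-distribˡ-sum {n} (γ c) _)) (*-distribˡ-sum {n} (β b) _)) ⟩
        β b * (γ c * ∑[ x < n ] (δ (b ⊹ c) x * w x))
          ≡⟨ cong (λ s → β b * (γ c * s)) (∑-pick (b ⊹ c) w) ⟩
        β b * (γ c * w (b ⊹ c)) ∎

    T : Subset n
    T = ⊕₂ G B C

    rich poor : Fin n → ℕ
    rich x = 𝟙 (does (x ∈? T))
    poor x = 𝟙 (not (does (x ∈? T)))

    does-∈⊕₂ : ∀ x → does (x ∈? T) ≡ ⌊ 2 ≤? r x ⌋
    does-∈⊕₂ x = trans (does-∈? x T) (lookup∘tabulate (λ y → ⌊ 2 ≤? r y ⌋) x)

    poor*r≤poor : ∀ x → poor x * r x ≤ poor x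
    poor*r≤poor x rewrite does-∈⊕₂ x with 2 ≤? r x
    ... | yes _   = z≤n
    ... | no r≱2 = subst (_≤ 1) (sym (+-identityʳ (r x))) (s≤s⁻¹ (≰⇒> r≱2))

    ∑poor*r+∣T∣≤n : ∑[ x < n ] (poor x * r x) + ∣ T ∣ ≤ n
    ∑poor*r+∣T∣≤n = begin
      ∑[ x < n ] (poor x * r x) + ∣ T ∣
        ≤⟨ +-monoˡ-≤ ∣ T ∣ (∑-mono-≤ poor*r≤poor) ⟩
      ∑[ x < n ] poor x + ∣ T ∣
        ≡⟨ cong (∑[ x < n ] poor x +_) (∣S∣≡∑𝟙∈ T) ⟩
      ∑[ x < n ] poor x + ∑[ x < n ] rich x
        ≡⟨ sym (∑-distrib-+ poor rich) ⟩
      ∑[ x < n ] (poor x + rich x)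
        ≡⟨ sum-cong-≗ (λ x → 𝟙-not (does (x ∈? T))) ⟩
      ∑[ x < n ] 1
        ≡⟨ ∑-one n ⟩
      n ∎
      where open ≤-Reasoning

    -- For fixed c, at most |T| elements b ∈ B have b + c ∈ T, because the
    -- translate of T by -c has |T| elements.
    ∣B∣∸∣T∣≤poor-shifts : ∀ c → ∣ B ∣ ∸ ∣ T ∣ ≤ ∑[ b < n ] (β b * poor (b ⊹ c))
    ∣B∣∸∣T∣≤poor-shifts c = m≤n+o⇒m∸n≤o ∣ B ∣ ∣ T ∣ (begin
      ∣ B ∣
        ≡⟨ ∣S∣≡∑𝟙∈ B ⟩
      ∑[ b < n ] β b
        ≤⟨ ∑-mono-≤ (λ b → 𝟙-split (does (b ∈? B)) (does ((b ⊹ c) ∈? T))) ⟩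
      ∑[ b < n ] (β b * poor (b ⊹ c) + rich (b ⊹ c))
        ≡⟨ ∑-distrib-+ (λ b → β b * poor (b ⊹ c)) (λ b → rich (b ⊹ c)) ⟩
      ∑[ b < n ] (β b * poor (b ⊹ c)) + ∑[ b < n ] rich (b ⊹ c)
        ≡⟨ cong (∑[ b < n ] (β b * poor (b ⊹ c)) +_) (trans (∑-translate rich c) (sym (∣S∣≡∑𝟙∈ T))) ⟩
      ∑[ b < n ] (β b * poor (b ⊹ c)) + ∣ T ∣
        ≡⟨ +-comm _ ∣ T ∣ ⟩
      ∣ T ∣ + ∑[ b < n ] (β b * poor (b ⊹ c)) ∎)
      where open ≤-Reasoning

    pairs-outside-T : ∣ C ∣ * (∣ B ∣ ∸ ∣ T ∣) ≤ ∑[ x < n ] (poor x * r x)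
    pairs-outside-T = begin
      ∣ C ∣ * (∣ B ∣ ∸ ∣ T ∣)
        ≡⟨ cong (_* (∣ B ∣ ∸ ∣ T ∣)) (∣S∣≡∑𝟙∈ C) ⟩
      (∑[ c < n ] γ c) * (∣ B ∣ ∸ ∣ T ∣)
        ≡⟨ *-distribʳ-sum (∣ B ∣ ∸ ∣ T ∣) γ ⟩
      ∑[ c < n ] (γ c * (∣ B ∣ ∸ ∣ T ∣))
        ≤⟨ ∑-mono-≤ (λ c → *-monoʳ-≤ (γ c) (∣B∣∸∣T∣≤poor-shifts c)) ⟩
      ∑[ c < n ] (γ c * ∑[ b < n ] (β b * poor (b ⊹ c)))
        ≡⟨ sum-cong-≗ {n} (λ c → *-distribˡ-sum {n} (γ c) _) ⟩
      ∑[ c < n ] ∑[ b < n ] (γ c * (β b * poor (b ⊹ c)))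
        ≡⟨ ∑-comm {n} {n} _ ⟩
      ∑[ b < n ] ∑[ c < n ] (γ c * (β b * poor (b ⊹ c)))
        ≡⟨ sum-cong-≗ (λ b → sum-cong-≗ λ c → x∙yz≈y∙xz (γ c) (β b) (poor (b ⊹ c))) ⟩
      ∑[ b < n ] ∑[ c < n ] (β b * (γ c * poor (b ⊹ c)))
        ≡⟨ sym (∑-weighted-repCount poor) ⟩
      ∑[ x < n ] (poor x * r x) ∎
      where open ≤-Reasoning

    counting-inequality : ∣ C ∣ * (∣ B ∣ ∸ ∣ T ∣) + ∣ T ∣ ≤ n
    counting-inequality = ≤-trans (+-monoˡ-≤ ∣ T ∣ pairs-outside-T) ∑poor*r+∣T∣≤n

open import Data.Integer using (+_; _-_; _⊓_; _⊖_) renaming (_≤_ to _≤ℤ_; _*_ to _*ℤ_; _+_ to _+ℤ_)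
import Data.Integer.Properties as ℤ
import Data.Integer.Tactic.RingSolver as ℤ-RingSolver

-- (c - 2)(d - 2) ≥ 0, rearranged so that it stays within ℕ.
2c+2d≤cd+4 : ∀ {c d} → 2 ≤ c → 2 ≤ d → 2 * c + 2 * d ≤ c * d + 4
2c+2d≤cd+4 {suc (suc c)} {suc (suc d)} (s≤s (s≤s z≤n)) (s≤s (s≤s z≤n)) =
  subst₂ _≤_ (expand-left c d) (expand-right c d) (m≤m+n (8 + 2 * c + 2 * d) (c * d))
  where
  expand-left : ∀ c d → 8 + 2 * c + 2 * d ≡ 2 * (2 + c) + 2 * (2 + d)
  expand-left = solve-∀
  expand-right : ∀ c d → 8 + 2 * c + 2 * d + c * d ≡ (2 + c) * (2 + d) + 4
  expand-right = solve-∀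

≤+⇒-≤ : ∀ {a m k} → a ≤ m + k → + a - + m ≤ℤ + k
≤+⇒-≤ {a} {m} {k} a≤m+k = begin
  + a - + m      ≡⟨ ℤ.m-n≡m⊖n a m ⟩
  a ⊖ m          ≤⟨ ℤ.⊖-monoˡ-≤ m a≤m+k ⟩
  (m + k) ⊖ m    ≡⟨ ℤ.⊖-≥ (m≤m+n m k) ⟩
  + (m + k ∸ m)  ≡⟨ cong +_ (m+n∸m≡n m k) ⟩
  + k            ∎
  where open ℤ.≤-Reasoning

first-bound-≡ : ∀ b c n → + 2 *ℤ + b +ℤ + 2 *ℤ + c - + 4 - + n ≡ + (2 * b + 2 * c) - + (4 + n)
first-bound-≡ b c n = begin
  + 2 *ℤ + b +ℤ + 2 *ℤ + c - + 4 - + n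
    ≡⟨ regroup (+ b) (+ c) (+ n) ⟩
  (+ 2 *ℤ + b +ℤ + 2 *ℤ + c) - (+ 4 +ℤ + n)
    ≡⟨ cong₂ (λ i j → i +ℤ j - (+ 4 +ℤ + n)) (sym (ℤ.pos-* 2 b)) (sym (ℤ.pos-* 2 c)) ⟩
  + (2 * b + 2 * c) - + (4 + n) ∎
  where
  open ≡-Reasoning
  regroup : ∀ i j k → + 2 *ℤ i +ℤ + 2 *ℤ j - + 4 - k ≡ (+ 2 *ℤ i +ℤ + 2 *ℤ j) - (+ 4 +ℤ k)
  regroup = ℤ-RingSolver.solve-∀

bound-from-counting : ∀ {b c τ n} → 2 ≤ b → 2 ≤ c → c * (b ∸ τ) + τ ≤ n →
  ((+ 2 *ℤ + b +ℤ + 2 *ℤ + c - + 4 - + n) ⊓ (+ b - + 1)) ≤ℤ + τ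
bound-from-counting {b} {c} {τ} {n} 2≤b 2≤c counting with b ≤? 1 + τ
... | yes b≤1+τ = ℤ.≤-trans (ℤ.i⊓j≤j _ _) (≤+⇒-≤ b≤1+τ)
... | no b≰1+τ = ℤ.≤-trans (ℤ.i⊓j≤i _ _)
  (subst (_≤ℤ + τ) (sym (first-bound-≡ b c n)) (≤+⇒-≤ 2b+2c≤4+n+τ))
  where
  2+τ≤b : 2 + τ ≤ b
  2+τ≤b = ≰⇒> b≰1+τ
  τ≤b : τ ≤ b
  τ≤b = m+n≤o⇒n≤o 2 2+τ≤b
  2≤b∸τ : 2 ≤ b ∸ τ
  2≤b∸τ = subst (_≤ b ∸ τ) (m+n∸n≡m 2 τ) (∸-monoˡ-≤ τ 2+τ≤b)
  regroup₁ : ∀ d τ c → 2 * (d + τ) + 2 * c ≡ (2 * c + 2 * d) + 2 * τ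
  regroup₁ = solve-∀
  regroup₂ : ∀ e τ → (e + 4) + 2 * τ ≡ (4 + τ) + (e + τ)
  regroup₂ = solve-∀
  regroup₃ : ∀ n τ → (4 + τ) + n ≡ (4 + n) + τ
  regroup₃ = solve-∀
  2b+2c≤4+n+τ : 2 * b + 2 * c ≤ (4 + n) + τ
  2b+2c≤4+n+τ = begin
    2 * b + 2 * c                  ≡⟨ cong (λ x → 2 * x + 2 * c) (sym (m∸n+n≡m τ≤b)) ⟩
    2 * (b ∸ τ + τ) + 2 * c        ≡⟨ regroup₁ (b ∸ τ) τ c ⟩
    (2 * c + 2 * (b ∸ τ)) + 2 * τ  ≤⟨ +-monoˡ-≤ (2 * τ) (2c+2d≤cd+4 2≤c 2≤b∸τ) ⟩
    (c * (b ∸ τ) + 4) + 2 * τ      ≡⟨ regroup₂ (c * (b ∸ τ)) τ ⟩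
    (4 + τ) + (c * (b ∸ τ) + τ)    ≤⟨ +-monoʳ-≤ (4 + τ) counting ⟩
    (4 + τ) + n                    ≡⟨ regroup₃ n τ ⟩
    (4 + n) + τ                    ∎
    where open ≤-Reasoning

corollary4p6 : (n : ℕ) (G : FiniteAbelianGroup n) (B C : Subset n) →
    2 ≤ ∣ B ∣ → 2 ≤ ∣ C ∣ →
    ((+ 2 *ℤ + ∣ B ∣ +ℤ + 2 *ℤ + ∣ C ∣ - + 4 - + n) ⊓ (+ ∣ B ∣ - + 1))
    ≤ℤ + ∣ ⊕₂ G B C ∣
corollary4p6 n G B C 2≤∣B∣ 2≤∣C∣ = bound-from-counting 2≤∣B∣ 2≤∣C∣ (counting-inequality G B C)
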